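{- Let $\mathbf{G3X}$ be any one of the calculi $\mathbf{G3E}$, $\mathbf{G3EN}$, $\mathbf{G3M}$, $\mathbf{G3MN}$, $\mathbf{G3C}$, $\mathbf{G3CN}$, $\mathbf{G3R}$, $\mathbf{G3K}$, $\mathbf{G3ED^\bot}$, $\mathbf{G3END^\bot}$, $\mathbf{G3ED^\Diamond}$, $\mathbf{G3ED}$, $\mathbf{G3END}$, $\mathbf{G3MD^\bot}$, $\mathbf{G3MND^\bot}$, $\mathbf{G3MD}$, $\mathbf{G3MND}$, $\mathbf{G3CD^\Diamond}$, $\mathbf{G3CD}$, $\mathbf{G3CND}$, $\mathbf{G3RD}$, $\mathbf{G3KD}$. All propositional rules ($L\wedge,R\wedge,L\vee,R\vee,L\supset,R\supset$) are height-preserving invertible in $\mathbf{G3X}$: if (an instance of) the conclusion of a propositional rule has a derivation of height $h$ in $\mathbf{G3X}$, then each of its premisses has a derivation in $\mathbf{G3X}$ of height at most $h$.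
   Context: Formulas are generated from countably many propositional variables $p_0,p_1,\dots$ and the $0$-ary constant $\bot$ by the binary connectives $\wedge,\vee,\supset$ and the unary operator $\Box$; $\neg A:=A\supset\bot$, $\top:=\bot\supset\bot$, $\Diamond A:=\neg\Box\neg A$. A sequent is an expression $\Gamma\Rightarrow\Delta$ with $\Gamma,\Delta$ finite, possibly empty, multisets of formulas; if $\Pi=A_1,\dots,A_m$ then $\Box\Pi=\Box A_1,\dots,\Box A_m$. The calculus $\mathbf{G3cp}$ has initial sequents $p,\Gamma\Rightarrow\Delta,p$ ($p$ a propositional variable), the zero-premiss rule $L\bot$ with conclusion $\bot,\Gamma\Rightarrow\Delta$, and the rules (premisses / conclusion): $L\wedge$: $A,B,\Gamma\Rightarrow\Delta$ / $A\wedge B,\Gamma\Rightarrow\Delta$; $R\wedge$: $\Gamma\Rightarrow\Delta,A$ and $\Gamma\Rightarrow\Delta,B$ / $\Gamma\Rightarrow\Delta,A\wedge B$; $L\vee$: $A,\Gamma\Rightarrow\Delta$ and $B,\Gamma\Rightarrow\Delta$ / $A\vee B,\Gamma\Rightarrow\Delta$; $R\vee$: $\Gamma\Rightarrow\Delta,A,B$ / $\Gamma\Rightarrow\Delta,A\vee B$; $L\supset$: $\Gamma\Rightarrow\Delta,A$ and $B,\Gamma\Rightarrow\Delta$ / $A\supset B,\Gamma\Rightarrow\Delta$; $R\supset$: $A,\Gamma\Rightarrow\Delta,B$ / $\Gamma\Rightarrow\Delta,A\supset B$. Modal and deontic rules ($\Gamma,\Delta$ arbitrary multisets): $LR$-$E$: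 $A\Rightarrow B$ and $B\Rightarrow A$ / $\Box A,\Gamma\Rightarrow\Delta,\Box B$; $LR$-$M$: $A\Rightarrow B$ / $\Box A,\Gamma\Rightarrow\Delta,\Box B$; $LR$-$R$: $A,\Pi\Rightarrow B$ / $\Box A,\Box\Pi,\Gamma\Rightarrow\Delta,\Box B$; $LR$-$C$ (for each $n\ge1$): $A_1,\dots,A_n\Rightarrow B$ and $B\Rightarrow A_1$, …, $B\Rightarrow A_n$ / $\Box A_1,\dots,\Box A_n,\Gamma\Rightarrow\Delta,\Box B$; $LR$-$K$: $\Pi\Rightarrow B$ / $\Box\Pi,\Gamma\Rightarrow\Delta,\Box B$; $R$-$N$: $\Rightarrow B$ / $\Gamma\Rightarrow\Delta,\Box B$; $L$-$D^\bot$: $A\Rightarrow$ / $\Box A,\Gamma\Rightarrow\Delta$; $L$-$D^{\Diamond_E}$ ($|\Pi|\le2$): $\Pi\Rightarrow$ and $\Rightarrow\Pi$ / $\Box\Pi,\Gamma\Rightarrow\Delta$; $L$-$D^{\Diamond_M}$ ($|\Pi|\le2$): $\Pi\Rightarrow$ / $\Box\Pi,\Gamma\Rightarrow\Delta$; $L$-$D^{\Diamond_C}$: $\Pi,\Sigma\Rightarrow$ and $\Rightarrow A,B$ for every $A\in\Pi$, $B\in\Sigma$ / $\Box\Pi,\Box\Sigma,\Gamma\Rightarrow\Delta$; $L$-$D^*$: $\Pi\Rightarrow$ / $\Box\Pi,\Gamma\Rightarrow\Delta$. Each calculus is $\mathbf{G3cp}$ plus: $\mathbf{G3E}$: $LR$-$E$;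 $\mathbf{G3EN}$: $LR$-$E$, $R$-$N$; $\mathbf{G3M}$: $LR$-$M$; $\mathbf{G3MN}$: $LR$-$M$, $R$-$N$; $\mathbf{G3C}$: $LR$-$C$; $\mathbf{G3CN}$: $LR$-$C$, $R$-$N$; $\mathbf{G3R}$: $LR$-$R$; $\mathbf{G3K}$: $LR$-$K$; $\mathbf{G3ED^\bot}$ / $\mathbf{G3END^\bot}$: rules of $\mathbf{G3E}$ / $\mathbf{G3EN}$ plus $L$-$D^\bot$; $\mathbf{G3ED^\Diamond}$: rules of $\mathbf{G3E}$ plus $L$-$D^{\Diamond_E}$; $\mathbf{G3ED}$ / $\mathbf{G3END}$: rules of $\mathbf{G3E}$ / $\mathbf{G3EN}$ plus $L$-$D^\bot$ and $L$-$D^{\Diamond_E}$; $\mathbf{G3MD^\bot}$ / $\mathbf{G3MND^\bot}$: rules of $\mathbf{G3M}$ / $\mathbf{G3MN}$ plus $L$-$D^\bot$; $\mathbf{G3MD}$ / $\mathbf{G3MND}$: rules of $\mathbf{G3M}$ / $\mathbf{G3MN}$ plus $L$-$D^{\Diamond_M}$; $\mathbf{G3CD^\Diamond}$: rules of $\mathbf{G3C}$ plus $L$-$D^{\Diamond_C}$; $\mathbf{G3CD}$, $\mathbf{G3CND}$, $\mathbf{G3RD}$, $\mathbf{G3KD}$: rules of $\mathbf{G3C}$, $\mathbf{G3CN}$, $\mathbf{G3R}$, $\mathbf{G3K}$ respectively plus $L$-$D^*$. A derivation is a finite upward-growing tree of sequents whose leaves are initial sequents or conclusions of $L\bot$ and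 each other node is the conclusion of a rule instance whose premisses are its children. The height of a derivation is the length of its longest branch minus one. -}

module Defs where

open import Data.Nat using (ℕ; zero; suc; _≤_; _⊔_)
open import Data.Bool using (Bool; true; false; T)
open import Data.List using (List; []; _∷_; _++_; map; concatMap; length)
open import Data.List.Relation.Binary.Permutation.Propositional using (_↭_)
open import Data.Product using (Σ; _×_)

infixr 30 _∧̇_ _∨̇_
infixr 25 _⊃̇_
infix 4 _⇒_

data Fml : Set where
  var  : ℕ → Fml
  ⊥̇    : Fml
  _∧̇_  : Fml → Fml → Fml
  _∨̇_  : Fml → Fml → Fml
  _⊃̇_  : Fml → Fml → Fml
  □    : Fml → Fml

-- Multisets are represented by lists; derivations below are
-- closed under permutation (_↭_) of antecedent and succedent, so a sequent is
-- effectively taken up to multiset equality.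
record Seq : Set where
  constructor _⇒_
  field
    ant : List Fml
    suc' : List Fml

□s : List Fml → List Fml
□s = map □

data Calc : Set where
  G3E G3EN G3M G3MN G3C G3CN G3R G3K : Calc
  G3ED⊥ G3END⊥ G3ED◇ G3ED G3END : Calc
  G3MD⊥ G3MND⊥ G3MD G3MND : Calc
  G3CD◇ G3CD G3CND G3RD G3KD : Calc

data Feature : Set where
  fE fM fR fC fK fN fD⊥ fD◇E fD◇M fD◇C fD* : Feature

has : Calc → Feature → Bool
has G3E    fE = true
has G3E    _  = false
has G3EN   fE = true
has G3EN   fN = true
has G3EN   _  = false
has G3M    fM = true
has G3M    _  = false
has G3MN   fM = true
has G3MN   fN = true
has G3MN   _  = false
has G3C    fC = true
has G3C    _  = false
has G3CN   fC = true
has G3CN   fN = true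
has G3CN   _  = false
has G3R    fR = true
has G3R    _  = false
has G3K    fK = true
has G3K    _  = false
has G3ED⊥  fE = true
has G3ED⊥  fD⊥ = true
has G3ED⊥  _  = false
has G3END⊥ fE = true
has G3END⊥ fN = true
has G3END⊥ fD⊥ = true
has G3END⊥ _  = false
has G3ED◇  fE = true
has G3ED◇  fD◇E = true
has G3ED◇  _  = false
has G3ED   fE = true
has G3ED   fD⊥ = true
has G3ED   fD◇E = true
has G3ED   _  = false
has G3END  fE = true
has G3END  fN = true
has G3END  fD⊥ = true
has G3END  fD◇E = true
has G3END  _  = false
has G3MD⊥  fM = true
has G3MD⊥  fD⊥ = true
has G3MD⊥  _  = false
has G3MND⊥ fM = true
has G3MND⊥ fN = true
has G3MND⊥ fD⊥ = true
has G3MND⊥ _  = false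
has G3MD   fM = true
has G3MD   fD◇M = true
has G3MD   _  = false
has G3MND  fM = true
has G3MND  fN = true
has G3MND  fD◇M = true
has G3MND  _  = false
has G3CD◇  fC = true
has G3CD◇  fD◇C = true
has G3CD◇  _  = false
has G3CD   fC = true
has G3CD   fD* = true
has G3CD   _  = false
has G3CND  fC = true
has G3CND  fN = true
has G3CND  fD* = true
has G3CND  _  = false
has G3RD   fR = true
has G3RD   fD* = true
has G3RD   _  = false
has G3KD   fK = true
has G3KD   fD* = true
has G3KD   _  = false

-- Rule instances of calculus X: list of premisses, conclusion
-- (conclusions in a canonical order; see Deriv for closure under permutation).
data Rule (X : Calc) : List Seq → Seq → Set where
  init : ∀ p Γ Δ → Rule X [] (var p ∷ Γ ⇒ var p ∷ Δ)
  L⊥   : ∀ Γ Δ → Rule X [] (⊥̇ ∷ Γ ⇒ Δ)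
  L∧   : ∀ A B Γ Δ → Rule X ((A ∷ B ∷ Γ ⇒ Δ) ∷ []) (A ∧̇ B ∷ Γ ⇒ Δ)
  R∧   : ∀ A B Γ Δ → Rule X ((Γ ⇒ A ∷ Δ) ∷ (Γ ⇒ B ∷ Δ) ∷ []) (Γ ⇒ A ∧̇ B ∷ Δ)
  L∨   : ∀ A B Γ Δ → Rule X ((A ∷ Γ ⇒ Δ) ∷ (B ∷ Γ ⇒ Δ) ∷ []) (A ∨̇ B ∷ Γ ⇒ Δ)
  R∨   : ∀ A B Γ Δ → Rule X ((Γ ⇒ A ∷ B ∷ Δ) ∷ []) (Γ ⇒ A ∨̇ B ∷ Δ)
  L⊃   : ∀ A B Γ Δ → Rule X ((Γ ⇒ A ∷ Δ) ∷ (B ∷ Γ ⇒ Δ) ∷ []) (A ⊃̇ B ∷ Γ ⇒ Δ)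
  R⊃   : ∀ A B Γ Δ → Rule X ((A ∷ Γ ⇒ B ∷ Δ) ∷ []) (Γ ⇒ A ⊃̇ B ∷ Δ)
  LR-E : T (has X fE) → ∀ A B Γ Δ →
         Rule X ((A ∷ [] ⇒ B ∷ []) ∷ (B ∷ [] ⇒ A ∷ []) ∷ []) (□ A ∷ Γ ⇒ □ B ∷ Δ)
  LR-M : T (has X fM) → ∀ A B Γ Δ →
         Rule X ((A ∷ [] ⇒ B ∷ []) ∷ []) (□ A ∷ Γ ⇒ □ B ∷ Δ)
  LR-R : T (has X fR) → ∀ A Π B Γ Δ →
         Rule X ((A ∷ Π ⇒ B ∷ []) ∷ []) (□ A ∷ □s Π ++ Γ ⇒ □ B ∷ Δ)
  -- LR-C with n ≥ 1 principal formulas A ∷ As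
  LR-C : T (has X fC) → ∀ A As B Γ Δ →
         Rule X ((A ∷ As ⇒ B ∷ []) ∷ map (λ C → B ∷ [] ⇒ C ∷ []) (A ∷ As))
                (□s (A ∷ As) ++ Γ ⇒ □ B ∷ Δ)
  LR-K : T (has X fK) → ∀ Π B Γ Δ →
         Rule X ((Π ⇒ B ∷ []) ∷ []) (□s Π ++ Γ ⇒ □ B ∷ Δ)
  R-N  : T (has X fN) → ∀ B Γ Δ →
         Rule X (([] ⇒ B ∷ []) ∷ []) (Γ ⇒ □ B ∷ Δ)
  L-D⊥ : T (has X fD⊥) → ∀ A Γ Δ →
         Rule X ((A ∷ [] ⇒ []) ∷ []) (□ A ∷ Γ ⇒ Δ)
  L-D◇E : T (has X fD◇E) → ∀ Π Γ Δ → length Π ≤ 2 →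
         Rule X ((Π ⇒ []) ∷ ([] ⇒ Π) ∷ []) (□s Π ++ Γ ⇒ Δ)
  L-D◇M : T (has X fD◇M) → ∀ Π Γ Δ → length Π ≤ 2 →
         Rule X ((Π ⇒ []) ∷ []) (□s Π ++ Γ ⇒ Δ)
  L-D◇C : T (has X fD◇C) → ∀ Π Σ Γ Δ →
         Rule X ((Π ++ Σ ⇒ []) ∷ concatMap (λ A → map (λ B → [] ⇒ A ∷ B ∷ []) Σ) Π)
                (□s Π ++ □s Σ ++ Γ ⇒ Δ)
  L-D*  : T (has X fD*) → ∀ Π Γ Δ →
         Rule X ((Π ⇒ []) ∷ []) (□s Π ++ Γ ⇒ Δ)

mutual
  data Deriv (X : Calc) : Seq → Set where
    by : ∀ {ps Γ Δ Γ' Δ'} → Rule X ps (Γ ⇒ Δ) → Γ ↭ Γ' → Δ ↭ Δ' →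
         Derivs X ps → Deriv X (Γ' ⇒ Δ')

  data Derivs (X : Calc) : List Seq → Set where
    []  : Derivs X []
    _∷_ : ∀ {s ss} → Deriv X s → Derivs X ss → Derivs X (s ∷ ss)

mutual
  height : ∀ {X s} → Deriv X s → ℕ
  height (by _ _ _ [])       = 0
  height (by _ _ _ (d ∷ ds)) = suc (height d ⊔ heights ds)

  heights : ∀ {X ss} → Derivs X ss → ℕ
  heights []       = 0
  heights (d ∷ ds) = height d ⊔ heights ds

_⊢[≤_]_ : Calc → ℕ → Seq → Set
X ⊢[≤ h ] s = Σ (Deriv X s) (λ d → height d ≤ h)

module Submission where

-- The view `Shape` sorts rule instances into left and right propositional
-- rules, whose premisses share the context of the conclusion, and context-free
-- rules (initial sequents, L⊥, modal and deontic rules), whose active formulas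
-- are atoms, ⊥ or boxes and whose premisses ignore the context.  Inverting the
-- rule of a compound F means replacing an occurrence of F in an end sequent by
-- the active formulas L ⇒ R of one premiss; this is done by induction on the
-- derivation (modules LeftInversion, RightInversion), looking at the last rule:
-- if F is its principal formula the goal is one of its premisses; if F lies in
-- the shared context of a propositional rule, invert the premisses and apply
-- the rule again; otherwise the rule is context-free, F lies in its context,
-- and the same rule concludes the new sequent.  Closure of derivations under
-- permutation at equal height (`permute`) keeps the bookkeeping height-exact.

open import Defs
open import Data.List using (List; []; _∷_; _++_; [_])
open import Data.List.Membership.Propositional using (_∈_)
open import Data.List.Membership.Propositional.Properties using (∈-++⁻; ∈-∃++)
open import Data.List.Relation.Unary.All using (All; []; _∷_; universal)
  renaming (lookup to lookupAll)
open import Data.List.Relation.Unary.All.Properties using (map⁺; ++⁺)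
open import Data.List.Relation.Unary.Any using (here; there)
open import Data.List.Relation.Binary.Permutation.Propositional
  using (_↭_; ↭-refl; ↭-sym; ↭-trans)
open import Data.List.Relation.Binary.Permutation.Propositional.Properties
  using (∈-resp-↭; ++⁺ˡ; shift; shifts; drop-∷)
open import Data.List.Properties using (++-assoc)
open import Data.Nat using (_≤_; z≤n; s≤s)
open import Data.Nat.Properties using (≤-trans; ≤-reflexive; m≤m⊔n; m≤n⊔m; ⊔-mono-≤; n≤1+n)
open import Data.Product using (Σ; _×_; _,_)
open import Data.Sum using (_⊎_; inj₁; inj₂)
open import Data.Empty using (⊥-elim)
open import Relation.Nullary using (¬_)
open import Relation.Binary.PropositionalEquality using (_≡_; refl; sym; subst)

locate : ∀ {F : Fml} P {Γ Γ₀} → P ++ Γ ↭ F ∷ Γ₀ →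
         F ∈ P ⊎ Σ (List Fml) (λ Γ₂ → Γ ↭ F ∷ Γ₂ × Γ₀ ↭ P ++ Γ₂)
locate {F} P π with ∈-++⁻ P (∈-resp-↭ (↭-sym π) (here refl))
... | inj₁ F∈P = inj₁ F∈P
... | inj₂ F∈Γ with ∈-∃++ F∈Γ
...   | as , bs , refl = inj₂ (as ++ bs , shift F as bs , drop-∷ (↭-trans (↭-sym π) moveF))
  where
    moveF : P ++ as ++ F ∷ bs ↭ F ∷ P ++ as ++ bs
    moveF = ↭-trans (++⁺ˡ P (shift F as bs)) (shift F P (as ++ bs))

pushInto : ∀ {F : Fml} L {Γ Γ₂} → Γ ↭ F ∷ Γ₂ → L ++ Γ ↭ F ∷ L ++ Γ₂
pushInto {F} L {Γ₂ = Γ₂} occ = ↭-trans (++⁺ˡ L occ) (shift F L Γ₂)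

regroup : ∀ P L {Γ₀ Γ₂ : List Fml} → Γ₀ ↭ P ++ Γ₂ → P ++ L ++ Γ₂ ↭ L ++ Γ₀
regroup P L rest = ↭-trans (shifts P L) (++⁺ˡ L (↭-sym rest))

height-by : ∀ {X ps Γ Δ Γ' Δ' Γ₁ Δ₁ Γ₁' Δ₁'}
  (r : Rule X ps (Γ ⇒ Δ)) (p : Γ ↭ Γ₁) (q : Δ ↭ Δ₁)
  (r' : Rule X ps (Γ' ⇒ Δ')) (p' : Γ' ↭ Γ₁') (q' : Δ' ↭ Δ₁') (ds : Derivs X ps) →
  height (by r p q ds) ≡ height (by r' p' q' ds)
height-by r p q r' p' q' []       = refl
height-by r p q r' p' q' (_ ∷ _) = refl

heights≤height : ∀ {X ps Γ Δ Γ₁ Δ₁} (r : Rule X ps (Γ ⇒ Δ)) (p : Γ ↭ Γ₁) (q : Δ ↭ Δ₁)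
  (ds : Derivs X ps) → heights ds ≤ height (by r p q ds)
heights≤height r p q []       = z≤n
heights≤height r p q (_ ∷ _) = n≤1+n _

raise : ∀ {X h h' s} → h ≤ h' → X ⊢[≤ h ] s → X ⊢[≤ h' ] s
raise h≤h' (d , d≤h) = d , ≤-trans d≤h h≤h'

permute : ∀ {X h Γ Δ Γ' Δ'} → X ⊢[≤ h ] (Γ ⇒ Δ) → Γ ↭ Γ' → Δ ↭ Δ' → X ⊢[≤ h ] (Γ' ⇒ Δ')
permute (by r p q ds , d≤h) σ τ =
  by r (↭-trans p σ) (↭-trans q τ) ds , ≤-trans (≤-reflexive (height-by r _ _ r p q ds)) d≤h

-- Active formulas L ⇒ R that one premiss of a context-sharing rule adds.
Extension : Set
Extension = List Fml × List Fml

premisses : List Extension → List Fml → List Fml → List Seq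
premisses []             Γ Δ = []
premisses ((L , R) ∷ es) Γ Δ = (L ++ Γ ⇒ R ++ Δ) ∷ premisses es Γ Δ

premiss : ∀ {X es L R Γ Δ} → (L , R) ∈ es → (ds : Derivs X (premisses es Γ Δ)) →
          X ⊢[≤ heights ds ] (L ++ Γ ⇒ R ++ Δ)
premiss (here refl) (d ∷ ds) = d , m≤m⊔n _ _
premiss (there i)   (d ∷ ds) = raise (m≤n⊔m _ _) (premiss i ds)

height-by-mono : ∀ {X} es {Γ Δ Γ' Δ' Γr Δr Γr' Δr' Γ₁ Δ₁ Γ₁' Δ₁'}
  (r : Rule X (premisses es Γ Δ) (Γr ⇒ Δr)) (p : Γr ↭ Γ₁) (q : Δr ↭ Δ₁)
  (r' : Rule X (premisses es Γ' Δ') (Γr' ⇒ Δr')) (p' : Γr' ↭ Γ₁') (q' : Δr' ↭ Δ₁')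
  (ds : Derivs X (premisses es Γ Δ)) (ds' : Derivs X (premisses es Γ' Δ')) →
  heights ds' ≤ heights ds → height (by r' p' q' ds') ≤ height (by r p q ds)
height-by-mono []      r p q r' p' q' []      []      _      = z≤n
height-by-mono (_ ∷ _) r p q r' p' q' (_ ∷ _) (_ ∷ _) ds'≤ds = s≤s ds'≤ds

-- Formulas that are never principal in a propositional rule.
data Simple : Fml → Set where
  atom : ∀ p → Simple (var p)
  bot  : Simple ⊥̇
  box  : ∀ A → Simple (□ A)

data Compound : Fml → Set where
  conj : ∀ A B → Compound (A ∧̇ B)
  disj : ∀ A B → Compound (A ∨̇ B)
  impl : ∀ A B → Compound (A ⊃̇ B)

-- The two classes are disjoint; this places a compound formula in the context
-- of every context-free rule.
compound-not-simple : ∀ {F} → Compound F → ¬ Simple F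
compound-not-simple (conj _ _) ()
compound-not-simple (disj _ _) ()
compound-not-simple (impl _ _) ()

compound-unique : ∀ {F} (c c' : Compound F) → c ≡ c'
compound-unique (conj _ _) (conj _ _) = refl
compound-unique (disj _ _) (disj _ _) = refl
compound-unique (impl _ _) (impl _ _) = refl

boxes-simple : ∀ Π → All Simple (□s Π)
boxes-simple Π = map⁺ (universal box Π)

leftPremisses : ∀ {F} → Compound F → List Extension
leftPremisses (conj A B) = (A ∷ B ∷ [] , []) ∷ []
leftPremisses (disj A B) = (A ∷ [] , []) ∷ (B ∷ [] , []) ∷ []
leftPremisses (impl A B) = ([] , A ∷ []) ∷ (B ∷ [] , []) ∷ []

rightPremisses : ∀ {F} → Compound F → List Extension
rightPremisses (conj A B) = ([] , A ∷ []) ∷ ([] , B ∷ []) ∷ []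
rightPremisses (disj A B) = ([] , A ∷ B ∷ []) ∷ []
rightPremisses (impl A B) = (A ∷ [] , B ∷ []) ∷ []

leftRule : ∀ {X F} (c : Compound F) Γ Δ → Rule X (premisses (leftPremisses c) Γ Δ) (F ∷ Γ ⇒ Δ)
leftRule (conj A B) = L∧ A B
leftRule (disj A B) = L∨ A B
leftRule (impl A B) = L⊃ A B

rightRule : ∀ {X F} (c : Compound F) Γ Δ → Rule X (premisses (rightPremisses c) Γ Δ) (Γ ⇒ F ∷ Δ)
rightRule (conj A B) = R∧ A B
rightRule (disj A B) = R∨ A B
rightRule (impl A B) = R⊃ A B

data Shape (X : Calc) : List Seq → Seq → Set where
  left  : ∀ {F} (c : Compound F) Γ Δ →
          Shape X (premisses (leftPremisses c) Γ Δ) (F ∷ Γ ⇒ Δ)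
  right : ∀ {F} (c : Compound F) Γ Δ →
          Shape X (premisses (rightPremisses c) Γ Δ) (Γ ⇒ F ∷ Δ)
  free  : ∀ {ps} P Q Γ Δ → All Simple P → All Simple Q →
          (∀ Γ' Δ' → Rule X ps (P ++ Γ' ⇒ Q ++ Δ')) → Shape X ps (P ++ Γ ⇒ Q ++ Δ)

shape : ∀ {X ps s} → Rule X ps s → Shape X ps s
shape (init p Γ Δ)        = free [ var p ] [ var p ] Γ Δ (atom p ∷ []) (atom p ∷ []) (init p)
shape (L⊥ Γ Δ)            = free [ ⊥̇ ] [] Γ Δ (bot ∷ []) [] L⊥
shape (L∧ A B Γ Δ)        = left (conj A B) Γ Δ
shape (R∧ A B Γ Δ)        = right (conj A B) Γ Δ
shape (L∨ A B Γ Δ)        = left (disj A B) Γ Δ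
shape (R∨ A B Γ Δ)        = right (disj A B) Γ Δ
shape (L⊃ A B Γ Δ)        = left (impl A B) Γ Δ
shape (R⊃ A B Γ Δ)        = right (impl A B) Γ Δ
shape (LR-E x A B Γ Δ)    = free [ □ A ] [ □ B ] Γ Δ (box A ∷ []) (box B ∷ []) (LR-E x A B)
shape (LR-M x A B Γ Δ)    = free [ □ A ] [ □ B ] Γ Δ (box A ∷ []) (box B ∷ []) (LR-M x A B)
shape (LR-R x A Π B Γ Δ)  =
  free (□s (A ∷ Π)) [ □ B ] Γ Δ (boxes-simple (A ∷ Π)) (box B ∷ []) (LR-R x A Π B)
shape (LR-C x A As B Γ Δ) =
  free (□s (A ∷ As)) [ □ B ] Γ Δ (boxes-simple (A ∷ As)) (box B ∷ []) (LR-C x A As B)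
shape (LR-K x Π B Γ Δ)    = free (□s Π) [ □ B ] Γ Δ (boxes-simple Π) (box B ∷ []) (LR-K x Π B)
shape (R-N x B Γ Δ)       = free [] [ □ B ] Γ Δ [] (box B ∷ []) (R-N x B)
shape (L-D⊥ x A Γ Δ)      = free [ □ A ] [] Γ Δ (box A ∷ []) [] (L-D⊥ x A)
shape (L-D◇E x Π Γ Δ l)   =
  free (□s Π) [] Γ Δ (boxes-simple Π) [] (λ Γ' Δ' → L-D◇E x Π Γ' Δ' l)
shape (L-D◇M x Π Γ Δ l)   =
  free (□s Π) [] Γ Δ (boxes-simple Π) [] (λ Γ' Δ' → L-D◇M x Π Γ' Δ' l)
shape {X} (L-D◇C x Π S Γ Δ) =
  subst (λ Γ₁ → Shape X _ (Γ₁ ⇒ Δ)) (++-assoc (□s Π) (□s S) Γ)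
    (free (□s Π ++ □s S) [] Γ Δ (++⁺ (boxes-simple Π) (boxes-simple S)) [] reassociated)
  where
    reassociated : ∀ Γ' Δ' → Rule X _ ((□s Π ++ □s S) ++ Γ' ⇒ [] ++ Δ')
    reassociated Γ' Δ' = subst (λ Γ₁ → Rule X _ (Γ₁ ⇒ Δ')) (sym (++-assoc (□s Π) (□s S) Γ'))
                               (L-D◇C x Π S Γ' Δ')
shape (L-D* x Π Γ Δ)      = free (□s Π) [] Γ Δ (boxes-simple Π) [] (L-D* x Π)

module LeftInversion {X : Calc} {F : Fml} (c : Compound F) {L R : List Fml}
                     (i : (L , R) ∈ leftPremisses c) where
  mutual
    invertL : ∀ {Γ Δ Γ₀} (d : Deriv X (Γ ⇒ Δ)) → Γ ↭ F ∷ Γ₀ →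
              X ⊢[≤ height d ] (L ++ Γ₀ ⇒ R ++ Δ)
    invertL (by r p q ds) occ with shape r
    ... | left c' _ _ with locate [ _ ] (↭-trans p occ)
    -- principal occurrence: the wanted sequent is a premiss of the last rule
    ...   | inj₁ (here refl) =
      raise (heights≤height r p q ds)
        (permute (premiss (subst (λ c'' → (L , R) ∈ leftPremisses c'') (compound-unique c c') i) ds)
                 (++⁺ˡ L (drop-∷ (↭-trans p occ))) (++⁺ˡ R q))
    ...   | inj₂ (_ , occ' , rest) = throughContext [ _ ] [] (leftRule c') r p q ds occ' rest
    invertL (by r p q ds) occ | right c' _ _ =
      throughContext [] [ _ ] (rightRule c') r p q ds (↭-trans p occ) ↭-refl
    invertL (by r p q ds) occ | free P Q _ Δc simpleP _ rule with locate P (↭-trans p occ)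
    -- context-free last rule: F is not among its simple active formulas
    ... | inj₁ F∈P = ⊥-elim (compound-not-simple c (lookupAll simpleP F∈P))
    ... | inj₂ (Γ₂ , _ , rest) =
      by (rule (L ++ Γ₂) (R ++ Δc)) (regroup P L rest) (regroup Q R (↭-sym q)) ds
      , ≤-reflexive (height-by _ _ _ r p q ds)

    -- The occurrence lies in the context Γc shared by the premisses of a
    -- propositional rule with active formulas P ⇒ Q.
    throughContext : ∀ P Q {es Γc Δc Γ Δ Γ₀ Γ₂}
      (rule : ∀ Γ' Δ' → Rule X (premisses es Γ' Δ') (P ++ Γ' ⇒ Q ++ Δ'))
      (r : Rule X (premisses es Γc Δc) (P ++ Γc ⇒ Q ++ Δc)) (p : P ++ Γc ↭ Γ) (q : Q ++ Δc ↭ Δ)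
      (ds : Derivs X (premisses es Γc Δc)) → Γc ↭ F ∷ Γ₂ → Γ₀ ↭ P ++ Γ₂ →
      X ⊢[≤ height (by r p q ds) ] (L ++ Γ₀ ⇒ R ++ Δ)
    throughContext P Q {es} {Δc = Δc} {Γ₂ = Γ₂} rule r p q ds occ rest =
      let (ds' , ds'≤ds) = invertPremisses es occ ds
      in by (rule (L ++ Γ₂) (R ++ Δc)) (regroup P L rest) (regroup Q R (↭-sym q)) ds'
         , height-by-mono es r p q _ _ _ ds ds' ds'≤ds

    invertPremisses : ∀ es {Γc Δc Γ₂} → Γc ↭ F ∷ Γ₂ → (ds : Derivs X (premisses es Γc Δc)) →
      Σ (Derivs X (premisses es (L ++ Γ₂) (R ++ Δc))) (λ ds' → heights ds' ≤ heights ds)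
    invertPremisses [] occ [] = [] , z≤n
    invertPremisses ((L' , R') ∷ es) occ (d ∷ ds) =
      let (e , e≤d) = permute (invertL d (pushInto L' occ)) (shifts L L') (shifts R R')
          (ds' , ds'≤ds) = invertPremisses es occ ds
      in e ∷ ds' , ⊔-mono-≤ e≤d ds'≤ds

module RightInversion {X : Calc} {F : Fml} (c : Compound F) {L R : List Fml}
                      (i : (L , R) ∈ rightPremisses c) where
  mutual
    invertR : ∀ {Γ Δ Δ₀} (d : Deriv X (Γ ⇒ Δ)) → Δ ↭ F ∷ Δ₀ →
              X ⊢[≤ height d ] (L ++ Γ ⇒ R ++ Δ₀)
    invertR (by r p q ds) occ with shape r
    ... | left c' _ _ =
      throughContext [ _ ] [] (leftRule c') r p q ds (↭-trans q occ) ↭-refl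
    ... | right c' _ _ with locate [ _ ] (↭-trans q occ)
    -- principal occurrence: the wanted sequent is a premiss of the last rule
    ...   | inj₁ (here refl) =
      raise (heights≤height r p q ds)
        (permute (premiss (subst (λ c'' → (L , R) ∈ rightPremisses c'') (compound-unique c c') i) ds)
                 (++⁺ˡ L p) (++⁺ˡ R (drop-∷ (↭-trans q occ))))
    ...   | inj₂ (_ , occ' , rest) = throughContext [] [ _ ] (rightRule c') r p q ds occ' rest
    invertR (by r p q ds) occ | free P Q Γc _ _ simpleQ rule with locate Q (↭-trans q occ)
    -- context-free last rule: F is not among its simple active formulas
    ... | inj₁ F∈Q = ⊥-elim (compound-not-simple c (lookupAll simpleQ F∈Q))
    ... | inj₂ (Δ₂ , _ , rest) =
      by (rule (L ++ Γc) (R ++ Δ₂)) (regroup P L (↭-sym p)) (regroup Q R rest) ds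
      , ≤-reflexive (height-by _ _ _ r p q ds)

    -- The occurrence lies in the context Δc shared by the premisses of a
    -- propositional rule with active formulas P ⇒ Q.
    throughContext : ∀ P Q {es Γc Δc Γ Δ Δ₀ Δ₂}
      (rule : ∀ Γ' Δ' → Rule X (premisses es Γ' Δ') (P ++ Γ' ⇒ Q ++ Δ'))
      (r : Rule X (premisses es Γc Δc) (P ++ Γc ⇒ Q ++ Δc)) (p : P ++ Γc ↭ Γ) (q : Q ++ Δc ↭ Δ)
      (ds : Derivs X (premisses es Γc Δc)) → Δc ↭ F ∷ Δ₂ → Δ₀ ↭ Q ++ Δ₂ →
      X ⊢[≤ height (by r p q ds) ] (L ++ Γ ⇒ R ++ Δ₀)
    throughContext P Q {es} {Γc = Γc} {Δ₂ = Δ₂} rule r p q ds occ rest =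
      let (ds' , ds'≤ds) = invertPremisses es occ ds
      in by (rule (L ++ Γc) (R ++ Δ₂)) (regroup P L (↭-sym p)) (regroup Q R rest) ds'
         , height-by-mono es r p q _ _ _ ds ds' ds'≤ds

    invertPremisses : ∀ es {Γc Δc Δ₂} → Δc ↭ F ∷ Δ₂ → (ds : Derivs X (premisses es Γc Δc)) →
      Σ (Derivs X (premisses es (L ++ Γc) (R ++ Δ₂))) (λ ds' → heights ds' ≤ heights ds)
    invertPremisses [] occ [] = [] , z≤n
    invertPremisses ((L' , R') ∷ es) occ (d ∷ ds) =
      let (e , e≤d) = permute (invertR d (pushInto R' occ)) (shifts L L') (shifts R R')
          (ds' , ds'≤ds) = invertPremisses es occ ds
      in e ∷ ds' , ⊔-mono-≤ e≤d ds'≤ds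

open LeftInversion using (invertL)
open RightInversion using (invertR)

lemma2 : ∀ (X : Calc) →
    (∀ A B Γ Δ (d : Deriv X (A ∧̇ B ∷ Γ ⇒ Δ)) →
       X ⊢[≤ height d ] (A ∷ B ∷ Γ ⇒ Δ))
    × (∀ A B Γ Δ (d : Deriv X (Γ ⇒ A ∧̇ B ∷ Δ)) →
       (X ⊢[≤ height d ] (Γ ⇒ A ∷ Δ)) × (X ⊢[≤ height d ] (Γ ⇒ B ∷ Δ)))
    × (∀ A B Γ Δ (d : Deriv X (A ∨̇ B ∷ Γ ⇒ Δ)) →
       (X ⊢[≤ height d ] (A ∷ Γ ⇒ Δ)) × (X ⊢[≤ height d ] (B ∷ Γ ⇒ Δ)))
    × (∀ A B Γ Δ (d : Deriv X (Γ ⇒ A ∨̇ B ∷ Δ)) →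
       X ⊢[≤ height d ] (Γ ⇒ A ∷ B ∷ Δ))
    × (∀ A B Γ Δ (d : Deriv X (A ⊃̇ B ∷ Γ ⇒ Δ)) →
       (X ⊢[≤ height d ] (Γ ⇒ A ∷ Δ)) × (X ⊢[≤ height d ] (B ∷ Γ ⇒ Δ)))
    × (∀ A B Γ Δ (d : Deriv X (Γ ⇒ A ⊃̇ B ∷ Δ)) →
       X ⊢[≤ height d ] (A ∷ Γ ⇒ B ∷ Δ))
lemma2 X =
    (λ A B Γ Δ d → invertL (conj A B) first d ↭-refl)
  , (λ A B Γ Δ d → invertR (conj A B) first d ↭-refl , invertR (conj A B) second d ↭-refl)
  , (λ A B Γ Δ d → invertL (disj A B) first d ↭-refl , invertL (disj A B) second d ↭-refl)
  , (λ A B Γ Δ d → invertR (disj A B) first d ↭-refl)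
  , (λ A B Γ Δ d → invertL (impl A B) first d ↭-refl , invertL (impl A B) second d ↭-refl)
  , (λ A B Γ Δ d → invertR (impl A B) first d ↭-refl)
  where
    first : ∀ {E : Set} {x : E} {xs} → x ∈ x ∷ xs
    first = here refl

    second : ∀ {E : Set} {x y : E} {xs} → y ∈ x ∷ y ∷ xs
    second = there (here refl)
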